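{- Let $P=P_n$ be the path with vertices $v_1,\dots,v_n$, let $k=\chi_{md}(P)$, and let $c:V(P)\to\{1,\dots,k\}$ be a majority dominator coloring of $P$ with $k$ colors. Then: (1) there are at most two colors of $c$ that appear on at least five vertices; (2) if $n\geq 11$, there are at least two colors of $c$ that appear on at most two vertices; (3) if $n\neq 2$, there is at most one color of $c$ that appears on exactly one vertex.
   Context: For a vertex $v$, $N[v]=N(v)\cup\{v\}$; $v$ dominates exactly the vertices of $N[v]$. A majority dominator coloring of $G$ is a proper vertex coloring such that for every vertex $v$ there is a color class $C$ with $|N[v]\cap C|\geq |C|/2$. $\chi_{md}(G)$ is the minimum number of color classes in a majority dominator coloring of $G$. -}

module Defs where

open import Data.Nat using (ℕ; suc; _*_; _≤_)
open import Data.Nat.Properties using (_≟_)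
open import Data.Fin using (Fin; toℕ)
import Data.Fin.Properties as FinP
open import Data.List using (List; length; filter)
open import Data.List.Base using ()
open import Data.Fin.Base using ()
open import Data.Product using (Σ; _×_; ∃)
open import Data.Sum using (_⊎_)
import Level
open import Relation.Nullary using (¬_; Dec)
open import Relation.Nullary.Decidable using (_⊎-dec_; _×-dec_)
open import Relation.Unary using (Pred; Decidable)
open import Relation.Binary.PropositionalEquality using (_≡_; _≢_)
open import Data.List using (allFin) public

-- The path P_n: vertices Fin n (v_1,...,v_n ↦ 0,...,n-1), v_i adjacent to v_{i+1}.
Adj : ∀ {n} → Fin n → Fin n → Set
Adj i j = (suc (toℕ i) ≡ toℕ j) ⊎ (suc (toℕ j) ≡ toℕ i)

Adj? : ∀ {n} (i j : Fin n) → Dec (Adj i j)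
Adj? i j = (suc (toℕ i) ≟ toℕ j) ⊎-dec (suc (toℕ j) ≟ toℕ i)

InN : ∀ {n} → Fin n → Fin n → Set
InN v u = (u ≡ v) ⊎ Adj v u

InN? : ∀ {n} (v u : Fin n) → Dec (InN v u)
InN? v u = (u FinP.≟ v) ⊎-dec Adj? v u

count : ∀ {m} {P : Pred (Fin m) Level.zero} → Decidable P → ℕ
count P? = length (filter P? (allFin _))

classSize : ∀ {n k} → (Fin n → Fin k) → Fin k → ℕ
classSize c a = count (λ u → c u FinP.≟ a)

nbrInClass : ∀ {n k} → (Fin n → Fin k) → Fin n → Fin k → ℕ
nbrInClass c v a = count (λ u → (c u FinP.≟ a) ×-dec InN? v u)

Proper : ∀ {n k} → (Fin n → Fin k) → Set
Proper {n} c = ∀ (i j : Fin n) → Adj i j → c i ≢ c j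

-- every one of the k colours is used, so there are exactly k colour classes
UsesAll : ∀ {n k} → (Fin n → Fin k) → Set
UsesAll {n} {k} c = ∀ (a : Fin k) → ∃ λ (u : Fin n) → c u ≡ a

-- majority dominator colouring of P_n with exactly k colour classes:
-- each v has a colour class C with |N[v] ∩ C| ≥ |C|/2 (i.e. 2|N[v] ∩ C| ≥ |C|)
IsMDColoring : ∀ {n k} → (Fin n → Fin k) → Set
IsMDColoring {n} {k} c =
  Proper c × UsesAll c ×
  (∀ (v : Fin n) → ∃ λ (a : Fin k) → classSize c a ≤ 2 * nbrInClass c v a)

IsChiMd : ℕ → ℕ → Set
IsChiMd n k =
  (∃ λ (c : Fin n → Fin k) → IsMDColoring c) ×
  (∀ (m : ℕ) (c : Fin n → Fin m) → IsMDColoring c → k ≤ m)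

module Submission where

-- On a path, a colour class meets a closed neighbourhood N[v] in at most one vertex on each
-- side of v (v itself counting on both sides), so a class dominating v has at most four
-- vertices, and at most two when v is an end of the path.
-- For (1) and (3), a violating colouring is turned into a majority dominator colouring
-- that misses a colour, contradicting the minimality of k. Three classes of size ≥ 5
-- dominate no vertex, so their vertices can be recoloured by two colours alternating along
-- the path. Two singleton classes merge into one class of size 2; when they are adjacent,
-- one of them is first shifted one step along the path.
-- For (2), if only one class S has at most two vertices, S dominates both ends of the path,
-- so its vertices lie near the ends. Every inner vertex is then dominated by a class of size
-- ≥ 3, which must contain both its neighbours; so the inner vertices alternate between two
-- classes X and Y of size ≤ 4, every other class lies among the two vertices at either end
-- and is small, hence is S, and n ≤ |S| + |X| + |Y| ≤ 10.

open import Defs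
open import Data.Empty using (⊥)
open import Data.Fin using (Fin; zero; suc; toℕ; fromℕ; fromℕ<; punchOut)
import Data.Fin.Properties as Finₚ
open import Data.List using (List; []; _∷_; length; filter; tabulate)
open import Data.List.Relation.Unary.All as All using (All; []; _∷_)
open import Data.List.Relation.Unary.AllPairs using ([]; _∷_)
open import Data.List.Relation.Unary.Unique.Propositional using (Unique)
open import Data.Nat using (ℕ; zero; suc; parity; _+_; _*_; _∸_; _≤_; _≥_; _<_; z≤n; s≤s; s≤s⁻¹)
open import Data.Nat.Properties
open import Data.Parity.Base using (Parity; 0ℙ; 1ℙ)
open import Data.Parity.Properties using (p≢p⁻¹; suc-homo-⁻¹)
open import Data.Product as Product using (Σ; ∃; _×_; _,_; proj₁; proj₂)
open import Data.Sum as Sum using (_⊎_; inj₁; inj₂; [_,_])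
open import Data.Unit using (tt)
open import Data.Vec.Functional using (updateAt)
open import Data.Vec.Functional.Properties using (updateAt-updates; updateAt-minimal)
open import Function using (_∘_)
open import Level using (0ℓ)
open import Relation.Binary.PropositionalEquality hiding ([_])
open import Relation.Nullary using (¬_; Dec; yes; no; contradiction)
open import Relation.Nullary.Decidable using (_×-dec_; _⊎-dec_)
open import Relation.Unary using (Pred; Decidable; U; _⊆_; _∪_)
open import Relation.Unary.Properties using (U?; _∪?_; _∩?_)

-- Counting in Fin m

length-filter-tabulate : ∀ {m} {A : Set} {P : Pred A 0ℓ} (P? : Decidable P) (f : Fin m → A) →
                         length (filter P? (tabulate f)) ≡ count (P? ∘ f)
length-filter-tabulate {zero}  P? f = refl
length-filter-tabulate {suc m} P? f with P? (f zero)
... | yes _ = cong suc (trans (length-filter-tabulate P? (f ∘ suc)) (sym (length-filter-tabulate (P? ∘ f) suc)))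
... | no  _ = trans (length-filter-tabulate P? (f ∘ suc)) (sym (length-filter-tabulate (P? ∘ f) suc))

module _ {m} {P : Pred (Fin (suc m)) 0ℓ} (P? : Decidable P) where

  count-yes : P zero → count P? ≡ suc (count (P? ∘ suc))
  count-yes p with P? zero
  ... | yes _ = cong suc (length-filter-tabulate P? suc)
  ... | no ¬p = contradiction p ¬p

  count-no : ¬ P zero → count P? ≡ count (P? ∘ suc)
  count-no ¬p with P? zero
  ... | yes p = contradiction p ¬p
  ... | no  _ = length-filter-tabulate P? suc

_except_ : ∀ {m} {P : Pred (Fin m) 0ℓ} → Decidable P → (u : Fin m) → Decidable (λ i → P i × i ≢ u)
(P? except u) i with P? i | i Finₚ.≟ u
... | yes p | no  i≢u = yes (p , i≢u)
... | yes _ | yes i≡u = no λ (_ , i≢u) → i≢u i≡u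
... | no ¬p | _       = no (¬p ∘ proj₁)

count-mono : ∀ {m} {P Q : Pred (Fin m) 0ℓ} (P? : Decidable P) (Q? : Decidable Q) →
             P ⊆ Q → count P? ≤ count Q?
count-mono {zero}  P? Q? P⊆Q = z≤n
count-mono {suc m} {P} {Q} P? Q? P⊆Q = step (P? zero) (Q? zero)
  where
  tail≤ : count (P? ∘ suc) ≤ count (Q? ∘ suc)
  tail≤ = count-mono (P? ∘ suc) (Q? ∘ suc) P⊆Q
  step : Dec (P zero) → Dec (Q zero) → count P? ≤ count Q?
  step (yes p) (yes q) = subst₂ _≤_ (sym (count-yes P? p)) (sym (count-yes Q? q)) (s≤s tail≤)
  step (yes p) (no ¬q) = contradiction (P⊆Q p) ¬q
  step (no ¬p) (yes q) = subst₂ _≤_ (sym (count-no P? ¬p)) (sym (count-yes Q? q)) (m≤n⇒m≤1+n tail≤)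
  step (no ¬p) (no ¬q) = subst₂ _≤_ (sym (count-no P? ¬p)) (sym (count-no Q? ¬q)) tail≤

count-cong : ∀ {m} {P Q : Pred (Fin m) 0ℓ} (P? : Decidable P) (Q? : Decidable Q) →
             P ⊆ Q → Q ⊆ P → count P? ≡ count Q?
count-cong P? Q? P⊆Q Q⊆P = ≤-antisym (count-mono P? Q? P⊆Q) (count-mono Q? P? Q⊆P)

count-∪ : ∀ {m} {P Q : Pred (Fin m) 0ℓ} (P? : Decidable P) (Q? : Decidable Q) →
          count (P? ∪? Q?) ≤ count P? + count Q?
count-∪ {zero}  P? Q? = z≤n
count-∪ {suc m} {P} {Q} P? Q? = step (P? zero) (Q? zero)
  where
  tail≤ : count ((P? ∪? Q?) ∘ suc) ≤ count (P? ∘ suc) + count (Q? ∘ suc)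
  tail≤ = count-∪ (P? ∘ suc) (Q? ∘ suc)
  step : Dec (P zero) → Dec (Q zero) → count (P? ∪? Q?) ≤ count P? + count Q?
  step (yes p) (yes q) =
    subst₂ _≤_ (sym (count-yes (P? ∪? Q?) (inj₁ p))) (cong₂ _+_ (sym (count-yes P? p)) (sym (count-yes Q? q)))
      (s≤s (≤-trans tail≤ (+-monoʳ-≤ (count (P? ∘ suc)) (n≤1+n _))))
  step (yes p) (no ¬q) =
    subst₂ _≤_ (sym (count-yes (P? ∪? Q?) (inj₁ p))) (cong₂ _+_ (sym (count-yes P? p)) (sym (count-no Q? ¬q)))
      (s≤s tail≤)
  step (no ¬p) (yes q) =
    subst₂ _≤_ (sym (count-yes (P? ∪? Q?) (inj₂ q))) (cong₂ _+_ (sym (count-no P? ¬p)) (sym (count-yes Q? q)))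
      (subst (suc (count ((P? ∪? Q?) ∘ suc)) ≤_) (sym (+-suc (count (P? ∘ suc)) (count (Q? ∘ suc)))) (s≤s tail≤))
  step (no ¬p) (no ¬q) =
    subst₂ _≤_ (sym (count-no (P? ∪? Q?) [ ¬p , ¬q ])) (cong₂ _+_ (sym (count-no P? ¬p)) (sym (count-no Q? ¬q)))
      tail≤

count-⊆-∪ : ∀ {m} {P Q R : Pred (Fin m) 0ℓ} (P? : Decidable P) (Q? : Decidable Q) (R? : Decidable R) →
            P ⊆ Q ∪ R → count P? ≤ count Q? + count R?
count-⊆-∪ P? Q? R? P⊆Q∪R = ≤-trans (count-mono P? (Q? ∪? R?) P⊆Q∪R) (count-∪ Q? R?)

count-full : ∀ {m} {P : Pred (Fin m) 0ℓ} (P? : Decidable P) → (∀ i → P i) → count P? ≡ m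
count-full {zero}  P? all = refl
count-full {suc m} P? all = trans (count-yes P? (all zero)) (cong suc (count-full (P? ∘ suc) (all ∘ suc)))

count-witness : ∀ {m} {P : Pred (Fin m) 0ℓ} (P? : Decidable P) → 1 ≤ count P? → ∃ P
count-witness {zero}  P? ()
count-witness {suc m} {P} P? 1≤count = step (P? zero)
  where
  step : Dec (P zero) → ∃ P
  step (yes p) = zero , p
  step (no ¬p) = Product.map suc (λ p → p) (count-witness (P? ∘ suc) (subst (1 ≤_) (count-no P? ¬p) 1≤count))

count-except : ∀ {m} {P : Pred (Fin m) 0ℓ} (P? : Decidable P) {u : Fin m} → P u →
               count P? ≡ suc (count (P? except u))
count-except {suc m} P? {zero} p =
  trans (count-yes P? p) (cong suc (trans tail≡ (sym (count-no (P? except zero) λ (_ , 0≢0) → 0≢0 refl))))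
  where
  tail≡ : count (P? ∘ suc) ≡ count ((P? except zero) ∘ suc)
  tail≡ = count-cong (P? ∘ suc) ((P? except zero) ∘ suc) (λ p → p , λ ()) proj₁
count-except {suc m} {P} P? {suc u} p = step (P? zero)
  where
  tail≡ : count (P? ∘ suc) ≡ suc (count ((P? except suc u) ∘ suc))
  tail≡ = trans (count-except (P? ∘ suc) p)
                (cong suc (count-cong ((P? ∘ suc) except u) ((P? except suc u) ∘ suc)
                  (λ (p , i≢u) → p , i≢u ∘ Finₚ.suc-injective) (λ (p , 1+i≢1+u) → p , 1+i≢1+u ∘ cong suc)))
  step : Dec (P zero) → count P? ≡ suc (count (P? except suc u))
  step (yes p₀) = trans (count-yes P? p₀) (cong suc (trans tail≡ (sym (count-yes (P? except suc u) (p₀ , λ ())))))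
  step (no ¬p₀) = trans (count-no P? ¬p₀) (trans tail≡ (cong suc (sym (count-no (P? except suc u) (¬p₀ ∘ proj₁)))))

count-positive : ∀ {m} {P : Pred (Fin m) 0ℓ} (P? : Decidable P) {u : Fin m} → P u → 1 ≤ count P?
count-positive P? p = subst (1 ≤_) (sym (count-except P? p)) (s≤s z≤n)

distinct-≤-count : ∀ {m} {P : Pred (Fin m) 0ℓ} (P? : Decidable P) {xs : List (Fin m)} →
                   Unique xs → All P xs → length xs ≤ count P?
distinct-≤-count P? []                 []         = z≤n
distinct-≤-count P? (x≢xs ∷ unique-xs) (px ∷ pxs) =
  subst (_ ≤_) (sym (count-except P? px))
    (s≤s (distinct-≤-count (P? except _) unique-xs (All.zipWith (λ (p , x≢y) → p , x≢y ∘ sym) (pxs , x≢xs))))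

distinct-witnesses : ∀ {m} {P : Pred (Fin m) 0ℓ} (P? : Decidable P) {k} → k ≤ count P? →
                     Σ (List (Fin m)) λ xs → length xs ≡ k × Unique xs × All P xs
distinct-witnesses P? {zero}  _       = [] , refl , [] , []
distinct-witnesses P? {suc k} k<count =
  let (u , pu) = count-witness P? (≤-trans (s≤s z≤n) k<count)
      (xs , len , unique-xs , pxs) =
        distinct-witnesses (P? except u) (s≤s⁻¹ (subst (suc k ≤_) (count-except P? pu) k<count))
  in u ∷ xs , cong suc len , All.map (λ (_ , x≢u) → x≢u ∘ sym) pxs ∷ unique-xs , pu ∷ All.map proj₁ pxs

count-subsingleton : ∀ {m} {P : Pred (Fin m) 0ℓ} (P? : Decidable P) → (∀ {i j} → P i → P j → i ≡ j) → count P? ≤ 1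
count-subsingleton {P = P} P? P-unique = ≮⇒≥ λ 1<count → two (distinct-witnesses P? 1<count)
  where
  two : (Σ (List _) λ xs → length xs ≡ 2 × Unique xs × All P xs) → ⊥
  two (_ ∷ _ ∷ [] , _ , (i≢j ∷ []) ∷ _ , pi ∷ pj ∷ []) = i≢j (P-unique pi pj)

count-≤1⇒subsingleton : ∀ {m} {P : Pred (Fin m) 0ℓ} (P? : Decidable P) → count P? ≤ 1 →
                         ∀ {i j} → P i → P j → i ≡ j
count-≤1⇒subsingleton P? count≤1 {i} {j} pi pj with i Finₚ.≟ j
... | yes i≡j = i≡j
... | no  i≢j = contradiction (distinct-≤-count P? ((i≢j ∷ []) ∷ [] ∷ []) (pi ∷ pj ∷ [])) (<⇒≱ (s≤s count≤1))

count-⊆-pair : ∀ {m} {P : Pred (Fin m) 0ℓ} (P? : Decidable P) {x y : Fin m} →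
               (∀ {i} → P i → i ≡ x ⊎ i ≡ y) → count P? ≤ 2
count-⊆-pair P? {x} {y} P⊆xy =
  ≤-trans (count-⊆-∪ P? (Finₚ._≟ x) (Finₚ._≟ y) P⊆xy)
          (+-mono-≤ (count-subsingleton (Finₚ._≟ x) λ i≡x j≡x → trans i≡x (sym j≡x))
                    (count-subsingleton (Finₚ._≟ y) λ i≡y j≡y → trans i≡y (sym j≡y)))

Adj-sym : ∀ {n} {i j : Fin n} → Adj i j → Adj j i
Adj-sym = Sum.swap

Adj-irrefl : ∀ {n} {i : Fin n} → ¬ Adj i i
Adj-irrefl (inj₁ 1+i≡i) = 1+n≢n 1+i≡i
Adj-irrefl (inj₂ 1+i≡i) = 1+n≢n 1+i≡i

InN⇒near : ∀ {n} {v u : Fin n} → InN v u → toℕ u ≤ suc (toℕ v) × toℕ v ≤ suc (toℕ u)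
InN⇒near {v = v} (inj₁ refl) = n≤1+n (toℕ v) , n≤1+n (toℕ v)
InN⇒near {v = v} {u} (inj₂ (inj₁ 1+v≡u)) =
  ≤-reflexive (sym 1+v≡u) , ≤-trans (n≤1+n (toℕ v)) (≤-trans (≤-reflexive 1+v≡u) (n≤1+n (toℕ u)))
InN⇒near {v = v} {u} (inj₂ (inj₂ 1+u≡v)) =
  ≤-trans (n≤1+n (toℕ u)) (≤-trans (≤-reflexive 1+u≡v) (n≤1+n (toℕ v))) , ≤-reflexive (sym 1+u≡v)

near⇒InN : ∀ {n} {u w : Fin n} → toℕ u ≤ suc (toℕ w) → toℕ w ≤ suc (toℕ u) → InN u w
near⇒InN u≤1+w w≤1+u = Sum.map₁ (sym ∘ Finₚ.toℕ-injective) (near u≤1+w w≤1+u)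
  where
  near : ∀ {x y} → x ≤ suc y → y ≤ suc x → x ≡ y ⊎ suc x ≡ y ⊎ suc y ≡ x
  near {zero}        {zero}        _ _ = inj₁ refl
  near {zero}        {suc zero}    _ _ = inj₂ (inj₁ refl)
  near {suc zero}    {zero}        _ _ = inj₂ (inj₂ refl)
  near {zero}        {suc (suc y)} _ (s≤s ())
  near {suc (suc x)} {zero}        (s≤s ()) _
  near {suc x}       {suc y}       x≤1+y y≤1+x =
    Sum.map (cong suc) (Sum.map (cong suc) (cong suc)) (near (s≤s⁻¹ x≤1+y) (s≤s⁻¹ y≤1+x))

common-neighbour⇒¬Adj : ∀ {n} {x y z : Fin n} → Adj y x → Adj y z → ¬ Adj x z
common-neighbour⇒¬Adj y~x y~z = go y~x y~z
  where
  go : ∀ {y x z : ℕ} → (suc y ≡ x ⊎ suc x ≡ y) → (suc y ≡ z ⊎ suc z ≡ y) → ¬ (suc x ≡ z ⊎ suc z ≡ x)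
  go (inj₁ refl) (inj₁ refl) (inj₁ ())
  go (inj₁ refl) (inj₁ refl) (inj₂ ())
  go (inj₁ refl) (inj₂ refl) (inj₁ ())
  go (inj₁ refl) (inj₂ refl) (inj₂ ())
  go (inj₂ refl) (inj₁ refl) (inj₁ ())
  go (inj₂ refl) (inj₁ refl) (inj₂ ())
  go (inj₂ refl) (inj₂ refl) (inj₁ ())
  go (inj₂ refl) (inj₂ refl) (inj₂ ())

neighbours-of-middle : ∀ {n} {x y z t : Fin n} → Adj y x → Adj y z → x ≢ z → Adj y t → t ≡ x ⊎ t ≡ z
neighbours-of-middle y~x y~z x≢z y~t =
  Sum.map Finₚ.toℕ-injective Finₚ.toℕ-injective (go y~x y~z (x≢z ∘ Finₚ.toℕ-injective) y~t)
  where
  go : ∀ {y x z t : ℕ} → (suc y ≡ x ⊎ suc x ≡ y) → (suc y ≡ z ⊎ suc z ≡ y) → x ≢ z →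
       (suc y ≡ t ⊎ suc t ≡ y) → t ≡ x ⊎ t ≡ z
  go (inj₁ refl) (inj₁ refl)    x≢z _           = contradiction refl x≢z
  go (inj₂ refl) (inj₂ 1+z≡1+x) x≢z _           = contradiction (sym (suc-injective 1+z≡1+x)) x≢z
  go (inj₁ refl) (inj₂ refl)    _   (inj₁ refl)  = inj₁ refl
  go (inj₁ refl) (inj₂ refl)    _   (inj₂ 1+t≡y) = inj₂ (suc-injective 1+t≡y)
  go (inj₂ refl) (inj₁ refl)    _   (inj₁ refl)  = inj₂ refl
  go (inj₂ refl) (inj₁ refl)    _   (inj₂ 1+t≡y) = inj₁ (suc-injective 1+t≡y)

third-vertex : ∀ {n} → n ≢ 2 → ∀ {p q : Fin n} → suc (toℕ p) ≡ toℕ q →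
               ∃ λ z → (Adj q z × z ≢ p) ⊎ (Adj p z × z ≢ q)
third-vertex {n} n≢2 {p} {q} 1+p≡q with suc (toℕ q) <? n
... | yes 1+q<n = fromℕ< 1+q<n , inj₁ (inj₁ (sym z≡1+q) , λ z≡p →
        <⇒≢ (s≤s (n≤1+n (toℕ p))) (trans (cong toℕ (sym z≡p)) (trans z≡1+q (cong suc (sym 1+p≡q)))))
  where z≡1+q = Finₚ.toℕ-fromℕ< 1+q<n
... | no  1+q≮n with toℕ p in p≡
...   | zero  = contradiction (≤-antisym (subst (λ x → n ≤ suc x) q≡1 (≮⇒≥ 1+q≮n)) (subst (_< n) q≡1 (Finₚ.toℕ<n q)))
                              n≢2
  where q≡1 = sym 1+p≡q
...   | suc j = fromℕ< j<n , inj₂ (inj₂ (cong suc z≡j) , λ z≡q →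
        <⇒≢ (s≤s (n≤1+n j)) (trans (sym z≡j) (trans (cong toℕ z≡q) (sym 1+p≡q))))
  where
  j<n : j < n
  j<n = ≤-trans (n≤1+n (suc j)) (subst (_< n) p≡ (Finₚ.toℕ<n p))
  z≡j = Finₚ.toℕ-fromℕ< j<n

parity-suc-≢ : ∀ x → parity x ≢ parity (suc x)
parity-suc-≢ x p≡p′ = p≢p⁻¹ (parity (suc x)) (trans (sym p≡p′) (sym (suc-homo-⁻¹ x)))

Adj⇒parity-≢ : ∀ {n} {i j : Fin n} → Adj i j → parity (toℕ i) ≢ parity (toℕ j)
Adj⇒parity-≢ {i = i} (inj₁ 1+i≡j) = subst (λ x → parity (toℕ i) ≢ parity x) 1+i≡j (parity-suc-≢ (toℕ i))
Adj⇒parity-≢ {j = j} (inj₂ 1+j≡i) = subst (λ x → parity x ≢ parity (toℕ j)) 1+j≡i (parity-suc-≢ (toℕ j) ∘ sym)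

inClass? : ∀ {n k} (c : Fin n → Fin k) (a : Fin k) → Decidable (λ u → c u ≡ a)
inClass? c a u = c u Finₚ.≟ a

inClassNear? : ∀ {n k} (c : Fin n → Fin k) (v : Fin n) (a : Fin k) → Decidable (λ u → c u ≡ a × InN v u)
inClassNear? c v a = inClass? c a ∩? InN? v

proper-near : ∀ {n k} {c : Fin n → Fin k} → Proper c → ∀ {u w} →
              toℕ u ≤ suc (toℕ w) → toℕ w ≤ suc (toℕ u) → c u ≡ c w → u ≡ w
proper-near proper u≤1+w w≤1+u cu≡cw with near⇒InN u≤1+w w≤1+u
... | inj₁ w≡u = sym w≡u
... | inj₂ u~w = contradiction cu≡cw (proper _ _ u~w)

module _ {n k} {c : Fin n → Fin k} (proper : Proper c) (v : Fin n) (a : Fin k) where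

  private
    left? : Decidable (λ (u : Fin n) → toℕ u ≤ toℕ v)
    left? u = toℕ u ≤? toℕ v

    right? : Decidable (λ (u : Fin n) → toℕ v ≤ toℕ u)
    right? u = toℕ v ≤? toℕ u

    left-≤1 : count (inClassNear? c v a ∩? left?) ≤ 1
    left-≤1 = count-subsingleton (inClassNear? c v a ∩? left?) λ ((cu , vu) , u≤v) ((cw , vw) , w≤v) →
      proper-near proper (≤-trans u≤v (proj₂ (InN⇒near vw))) (≤-trans w≤v (proj₂ (InN⇒near vu))) (trans cu (sym cw))

    right-≤1 : count (inClassNear? c v a ∩? right?) ≤ 1
    right-≤1 = count-subsingleton (inClassNear? c v a ∩? right?) λ ((cu , vu) , v≤u) ((cw , vw) , v≤w) →
      proper-near proper (≤-trans (proj₁ (InN⇒near vu)) (s≤s v≤w)) (≤-trans (proj₁ (InN⇒near vw)) (s≤s v≤u))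
                         (trans cu (sym cw))

  nbrInClass-≤2 : nbrInClass c v a ≤ 2
  nbrInClass-≤2 = ≤-trans (count-⊆-∪ (inClassNear? c v a) (inClassNear? c v a ∩? left?) (inClassNear? c v a ∩? right?) split)
                          (+-mono-≤ left-≤1 right-≤1)
    where
    split : ∀ {u} → c u ≡ a × InN v u →
            (c u ≡ a × InN v u) × toℕ u ≤ toℕ v ⊎ (c u ≡ a × InN v u) × toℕ v ≤ toℕ u
    split {u} member = Sum.map (member ,_) (member ,_) (≤-total (toℕ u) (toℕ v))

  nbrInClass-≤1-at-start : (∀ u → toℕ v ≤ toℕ u) → nbrInClass c v a ≤ 1
  nbrInClass-≤1-at-start v-first =
    ≤-trans (count-mono (inClassNear? c v a) (inClassNear? c v a ∩? right?) (λ member → member , v-first _)) right-≤1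

  nbrInClass-≤1-at-end : (∀ u → toℕ u ≤ toℕ v) → nbrInClass c v a ≤ 1
  nbrInClass-≤1-at-end v-last =
    ≤-trans (count-mono (inClassNear? c v a) (inClassNear? c v a ∩? left?) (λ member → member , v-last _)) left-≤1

  -- A neighbour u outside the class leaves only the side of v opposite to u for its members.
  nbrInClass-≥2⇒neighbour∈class : 2 ≤ nbrInClass c v a → ∀ {u} → Adj v u → c u ≡ a
  nbrInClass-≥2⇒neighbour∈class 2≤nbr {u} v~u with c u Finₚ.≟ a
  ... | yes cu≡a = cu≡a
  ... | no  cu≢a = contradiction (≤-trans 2≤nbr (one-side v~u)) 1+n≰n
    where
    one-side : Adj v u → nbrInClass c v a ≤ 1
    one-side (inj₁ 1+v≡u) =
      ≤-trans (count-mono (inClassNear? c v a) (inClassNear? c v a ∩? left?) λ m → m , left-of m) left-≤1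
      where
      left-of : ∀ {m} → c m ≡ a × InN v m → toℕ m ≤ toℕ v
      left-of (_  , inj₁ refl)         = ≤-refl
      left-of (cm , inj₂ (inj₁ 1+v≡m)) =
        contradiction (trans (cong c (Finₚ.toℕ-injective (trans (sym 1+v≡u) 1+v≡m))) cm) cu≢a
      left-of (_  , inj₂ (inj₂ 1+m≡v)) = ≤-trans (n≤1+n _) (≤-reflexive 1+m≡v)
    one-side (inj₂ 1+u≡v) =
      ≤-trans (count-mono (inClassNear? c v a) (inClassNear? c v a ∩? right?) λ m → m , right-of m) right-≤1
      where
      right-of : ∀ {m} → c m ≡ a × InN v m → toℕ v ≤ toℕ m
      right-of (_  , inj₁ refl)         = ≤-refl
      right-of (_  , inj₂ (inj₁ 1+v≡m)) = ≤-trans (n≤1+n _) (≤-reflexive 1+v≡m)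
      right-of (cm , inj₂ (inj₂ 1+m≡v)) =
        contradiction (trans (cong c (Finₚ.toℕ-injective (suc-injective (trans 1+u≡v (sym 1+m≡v))))) cm) cu≢a

record Dominates {n k} (c : Fin n → Fin k) (v : Fin n) (a : Fin k) : Set where
  constructor dominates
  field
    meets    : 1 ≤ nbrInClass c v a
    majority : classSize c a ≤ 2 * nbrInClass c v a

-- IsMDColoring without the requirement that every colour be used; an unused colour would
-- dominate everything vacuously, which `meets` rules out.
MajorityDominated : ∀ {n k} → (Fin n → Fin k) → Set
MajorityDominated {n} c = (v : Fin n) → ∃ (Dominates c v)

module _ {n k k′ : ℕ} {c : Fin n → Fin k} {d : Fin n → Fin k′} {v : Fin n} {a : Fin k} {b : Fin k′} where

  dominates-mono : classSize d b ≤ classSize c a → nbrInClass c v a ≤ nbrInClass d v b →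
                   Dominates c v a → Dominates d v b
  dominates-mono size≤ nbr≤ (dominates 1≤nbr size≤2nbr) =
    dominates (≤-trans 1≤nbr nbr≤) (≤-trans size≤ (≤-trans size≤2nbr (*-monoʳ-≤ 2 nbr≤)))

  dominates-transfer : (∀ {u} → c u ≡ a → d u ≡ b) → (∀ {u} → d u ≡ b → c u ≡ a) →
                       Dominates c v a → Dominates d v b
  dominates-transfer to from = dominates-mono
    (count-mono (inClass? d b) (inClass? c a) from)
    (count-mono (inClassNear? c v a) (inClassNear? d v b) λ (cu≡a , vu) → to cu≡a , vu)

module _ {n k} {c : Fin n → Fin k} {v : Fin n} {a : Fin k} where

  dominates-member : Dominates c v a → ∃ λ u → c u ≡ a × InN v u
  dominates-member (dominates 1≤nbr _) = count-witness (inClassNear? c v a) 1≤nbr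

  small-class-dominates : classSize c a ≤ 2 → ∀ {u} → c u ≡ a → InN v u → Dominates c v a
  small-class-dominates size≤2 cu≡a vu = dominates 1≤nbr (≤-trans size≤2 (*-monoʳ-≤ 2 1≤nbr))
    where 1≤nbr = count-positive (inClassNear? c v a) (cu≡a , vu)

  dominating-class-≤4 : Proper c → Dominates c v a → classSize c a ≤ 4
  dominating-class-≤4 proper (dominates _ size≤2nbr) = ≤-trans size≤2nbr (*-monoʳ-≤ 2 (nbrInClass-≤2 proper v a))

  dominating-class-≤2 : nbrInClass c v a ≤ 1 → Dominates c v a → classSize c a ≤ 2
  dominating-class-≤2 nbr≤1 (dominates _ size≤2nbr) = ≤-trans size≤2nbr (*-monoʳ-≤ 2 nbr≤1)

isMDColoring⇒majorityDominated : ∀ {n k} {c : Fin n → Fin k} → IsMDColoring c → MajorityDominated c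
isMDColoring⇒majorityDominated {c = c} (_ , surjective , dominated) v =
  let (a , size≤2nbr) = dominated v
      (u , cu≡a) = surjective a
  in a , dominates (positive (≤-trans (count-positive (inClass? c a) cu≡a) size≤2nbr)) size≤2nbr
  where
  positive : ∀ {x} → 1 ≤ 2 * x → 1 ≤ x
  positive {suc _} _ = s≤s z≤n

-- Minimality of χ_md

module _ {n m} (d : Fin n → Fin (suc m)) {b : Fin (suc m)} (unused : ∀ u → d u ≢ b) where

  dropColour : Fin n → Fin m
  dropColour u = punchOut (unused u ∘ sym)

  dropColour-proper : Proper d → Proper dropColour
  dropColour-proper proper i j i~j = proper i j i~j ∘ Finₚ.punchOut-injective {i = b} _ _

  dropColour-majorityDominated : MajorityDominated d → MajorityDominated dropColour
  dropColour-majorityDominated dominated v =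
    let (a , d-dominates) = dominated v
        (w , dw≡a , _) = dominates-member d-dominates
        b≢a = λ b≡a → unused w (trans dw≡a (sym b≡a))
    in punchOut b≢a , dominates-transfer (Finₚ.punchOut-cong b) (Finₚ.punchOut-injective {i = b} _ _) d-dominates

chiMd-minimal : ∀ {n k} → IsChiMd n k → ∀ m (d : Fin n → Fin m) → Proper d → MajorityDominated d → k ≤ m
chiMd-minimal χ m d proper dominated with Finₚ.all? (λ b → Finₚ.any? (λ u → d u Finₚ.≟ b))
... | yes surjective = proj₂ χ m d (proper , surjective , λ v → Product.map₂ Dominates.majority (dominated v))
... | no ¬surjective with Finₚ.¬∀⟶∃¬ m _ (λ b → Finₚ.any? (λ u → d u Finₚ.≟ b)) ¬surjective
chiMd-minimal χ zero    d proper dominated | no _ | () , _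
chiMd-minimal χ (suc m) d proper dominated | no _ | b , ¬used =
  m≤n⇒m≤1+n (chiMd-minimal χ m (dropColour d unused) (dropColour-proper d unused proper)
                                (dropColour-majorityDominated d unused dominated))
  where
  unused : ∀ u → d u ≢ b
  unused u du≡b = ¬used (u , du≡b)

optimal-uses-every-colour : ∀ {n k} → IsChiMd n k → (d : Fin n → Fin k) → Proper d → MajorityDominated d →
                            ∀ b → ¬ (∀ u → d u ≢ b)
optimal-uses-every-colour {k = suc k} χ d proper dominated b unused =
  1+n≰n (chiMd-minimal χ k (dropColour d unused) (dropColour-proper d unused proper)
                            (dropColour-majorityDominated d unused dominated))
-- (1) At most two colours appear on five or more vertices

module ThreeLargeClasses {n k} (χ : IsChiMd n k) {c : Fin n → Fin k} (proper : Proper c)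
                         (dominated : MajorityDominated c) {A B C : Fin k} (A≢B : A ≢ B) (A≢C : A ≢ C) (B≢C : B ≢ C)
                         (5≤|A| : 5 ≤ classSize c A) (5≤|B| : 5 ≤ classSize c B) (5≤|C| : 5 ≤ classSize c C) where

  Large : Fin k → Set
  Large x = x ≡ A ⊎ x ≡ B ⊎ x ≡ C

  large? : Decidable Large
  large? x = (x Finₚ.≟ A) ⊎-dec (x Finₚ.≟ B) ⊎-dec (x Finₚ.≟ C)

  large-≥5 : ∀ {x} → Large x → 5 ≤ classSize c x
  large-≥5 (inj₁ refl)        = 5≤|A|
  large-≥5 (inj₂ (inj₁ refl)) = 5≤|B|
  large-≥5 (inj₂ (inj₂ refl)) = 5≤|C|

  alternate : Parity → Fin k
  alternate 0ℙ = A
  alternate 1ℙ = B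

  alternate-large : ∀ p → Large (alternate p)
  alternate-large 0ℙ = inj₁ refl
  alternate-large 1ℙ = inj₂ (inj₁ refl)

  alternate-injective : ∀ {p q} → alternate p ≡ alternate q → p ≡ q
  alternate-injective {0ℙ} {0ℙ} _   = refl
  alternate-injective {0ℙ} {1ℙ} A≡B = contradiction A≡B A≢B
  alternate-injective {1ℙ} {0ℙ} B≡A = contradiction (sym B≡A) A≢B
  alternate-injective {1ℙ} {1ℙ} _   = refl

  alternate-≢C : ∀ p → alternate p ≢ C
  alternate-≢C 0ℙ = A≢C
  alternate-≢C 1ℙ = B≢C

  recolour : Fin n → Fin k
  recolour u with large? (c u)
  ... | yes _ = alternate (parity (toℕ u))
  ... | no  _ = c u

  recolour-spec : ∀ u → (Large (c u) × recolour u ≡ alternate (parity (toℕ u))) ⊎ (¬ Large (c u) × recolour u ≡ c u)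
  recolour-spec u with large? (c u)
  ... | yes large  = inj₁ (large , refl)
  ... | no  ¬large = inj₂ (¬large , refl)

  recolour-proper : Proper recolour
  recolour-proper i j i~j ri≡rj with recolour-spec i | recolour-spec j
  ... | inj₁ (_ , ri) | inj₁ (_ , rj)     = Adj⇒parity-≢ i~j (alternate-injective (trans (sym ri) (trans ri≡rj rj)))
  ... | inj₁ (_ , ri) | inj₂ (¬Lj , rj)   = ¬Lj (subst Large (trans (sym ri) (trans ri≡rj rj)) (alternate-large _))
  ... | inj₂ (¬Li , ri) | inj₁ (_ , rj)   = ¬Li (subst Large (trans (sym rj) (trans (sym ri≡rj) ri)) (alternate-large _))
  ... | inj₂ (_ , ri) | inj₂ (_ , rj)     = proper i j i~j (trans (sym ri) (trans ri≡rj rj))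

  recolour-misses-C : ∀ u → recolour u ≢ C
  recolour-misses-C u ru≡C with recolour-spec u
  ... | inj₁ (_ , ru)     = alternate-≢C _ (trans (sym ru) ru≡C)
  ... | inj₂ (¬Lu , ru)   = ¬Lu (inj₂ (inj₂ (trans (sym ru) ru≡C)))

  recolour-dominated : MajorityDominated recolour
  recolour-dominated v = a , dominates-transfer to from c-dominates
    where
    a = proj₁ (dominated v)
    c-dominates = proj₂ (dominated v)
    ¬La : ¬ Large a
    ¬La La = 1+n≰n (≤-trans (large-≥5 La) (dominating-class-≤4 proper c-dominates))
    to : ∀ {u} → c u ≡ a → recolour u ≡ a
    to {u} cu≡a with recolour-spec u
    ... | inj₁ (Lu , _) = contradiction (subst Large cu≡a Lu) ¬La
    ... | inj₂ (_ , ru) = trans ru cu≡a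
    from : ∀ {u} → recolour u ≡ a → c u ≡ a
    from {u} ru≡a with recolour-spec u
    ... | inj₁ (_ , ru) = contradiction (subst Large (trans (sym ru) ru≡a) (alternate-large _)) ¬La
    ... | inj₂ (_ , ru) = trans (sym ru) ru≡a

  impossible : ⊥
  impossible = optimal-uses-every-colour χ recolour recolour-proper recolour-dominated C recolour-misses-C

at-most-two-large-classes : ∀ {n k} → IsChiMd n k → {c : Fin n → Fin k} → Proper c → MajorityDominated c →
                            count (λ a → 5 ≤? classSize c a) ≤ 2
at-most-two-large-classes χ {c} proper dominated =
  ≮⇒≥ λ 2<count → three-large (distinct-witnesses (λ a → 5 ≤? classSize c a) 2<count)
  where
  three-large : (Σ (List _) λ as → length as ≡ 3 × Unique as × All (λ a → 5 ≤ classSize c a) as) → ⊥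
  three-large (_ ∷ _ ∷ _ ∷ [] , _ , (A≢B ∷ A≢C ∷ []) ∷ (B≢C ∷ []) ∷ [] ∷ [] , 5≤|A| ∷ 5≤|B| ∷ 5≤|C| ∷ []) =
    ThreeLargeClasses.impossible χ proper dominated A≢B A≢C B≢C 5≤|A| 5≤|B| 5≤|C|

-- (2) At least two colours appear on at most two vertices, once n ≥ 11

module OneSmallClass {m k} {c : Fin (11 + m) → Fin k} (proper : Proper c) (dominated : MajorityDominated c)
                     (small-unique : ∀ {a b} → classSize c a ≤ 2 → classSize c b ≤ 2 → a ≡ b) where

  Low High Middle : Fin (11 + m) → Set
  Low t = toℕ t ≤ 1
  High t = 9 + m ≤ toℕ t
  Middle t = 2 ≤ toℕ t × toℕ t ≤ 8 + m

  middle-or-end : ∀ t → Middle t ⊎ Low t ⊎ High t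
  middle-or-end t with 2 ≤? toℕ t | toℕ t ≤? 8 + m
  ... | yes 2≤t | yes t≤8+m = inj₁ (2≤t , t≤8+m)
  ... | no  2≰t | _         = inj₂ (inj₁ (s≤s⁻¹ (≰⇒> 2≰t)))
  ... | yes _   | no  t≰8+m = inj₂ (inj₂ (≰⇒> t≰8+m))

  last : Fin (11 + m)
  last = fromℕ (10 + m)

  S : Fin k
  S = proj₁ (dominated zero)

  |S|≤2 : classSize c S ≤ 2
  |S|≤2 = dominating-class-≤2 (nbrInClass-≤1-at-start proper zero S λ _ → z≤n) (proj₂ (dominated zero))

  S-near-first : ∃ λ s₀ → c s₀ ≡ S × Low s₀
  S-near-first =
    let (s₀ , cs₀≡S , first~s₀) = dominates-member (proj₂ (dominated zero))
    in s₀ , cs₀≡S , proj₁ (InN⇒near first~s₀)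

  S-near-last : ∃ λ s₁ → c s₁ ≡ S × High s₁
  S-near-last =
    let (T , T-dominates) = dominated last
        toℕ-last = Finₚ.toℕ-fromℕ (10 + m)
        |T|≤2 = dominating-class-≤2
                  (nbrInClass-≤1-at-end proper last T λ u → subst (toℕ u ≤_) (sym toℕ-last) (Finₚ.toℕ≤pred[n] u))
                  T-dominates
        (s₁ , cs₁≡T , last~s₁) = dominates-member T-dominates
    in s₁ , trans cs₁≡T (small-unique |T|≤2 |S|≤2) ,
       s≤s⁻¹ (subst (_≤ suc (toℕ s₁)) toℕ-last (proj₂ (InN⇒near last~s₁)))

  middle-not-S : ∀ {t} → Middle t → c t ≢ S
  middle-not-S {t} (2≤t , t≤8+m) ct≡S =
    let (s₀ , cs₀≡S , s₀≤1) = S-near-first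
        (s₁ , cs₁≡S , 9+m≤s₁) = S-near-last
        s₀<s₁ = ≤-trans (s≤s s₀≤1) (≤-trans (m≤m+n 2 (7 + m)) 9+m≤s₁)
        s₀<t = ≤-trans (s≤s s₀≤1) 2≤t
        t<s₁ = ≤-trans (s≤s t≤8+m) 9+m≤s₁
        3≤|S| = distinct-≤-count (inClass? c S)
                  ((<⇒≢′ s₀<s₁ ∷ <⇒≢′ s₀<t ∷ []) ∷ (<⇒≢′ t<s₁ ∘ sym ∷ []) ∷ [] ∷ [])
                  (cs₀≡S ∷ cs₁≡S ∷ ct≡S ∷ [])
    in 1+n≰n (≤-trans 3≤|S| |S|≤2)
    where
    <⇒≢′ : ∀ {i j : Fin (11 + m)} → toℕ i < toℕ j → i ≢ j
    <⇒≢′ i<j i≡j = <⇒≢ i<j (cong toℕ i≡j)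

  middle-step : ∀ {u w} → 2 ≤ toℕ u → toℕ w ≡ 2 + toℕ u → toℕ w ≤ 8 + m → c u ≡ c w × classSize c (c u) ≤ 4
  middle-step {u} {w} 2≤u w≡2+u w≤8+m =
    trans cu≡a (sym cw≡a) , subst (λ x → classSize c x ≤ 4) (sym cu≡a) (dominating-class-≤4 proper a-dominates)
    where
    1+u<n : suc (toℕ u) < 11 + m
    1+u<n = ≤-trans (≤-reflexive (sym w≡2+u)) (≤-trans w≤8+m (m≤n+m (8 + m) 3))
    v = fromℕ< 1+u<n
    v≡1+u : toℕ v ≡ suc (toℕ u)
    v≡1+u = Finₚ.toℕ-fromℕ< 1+u<n
    a = proj₁ (dominated v)
    a-dominates = proj₂ (dominated v)
    a≢S : a ≢ S
    a≢S a≡S =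
      let (r , cr≡a , v~r) = dominates-member a-dominates
          (r≤1+v , v≤1+r) = InN⇒near v~r
      in middle-not-S (≤-trans 2≤u (s≤s⁻¹ (subst (_≤ suc (toℕ r)) v≡1+u v≤1+r)) ,
                       ≤-trans (subst (toℕ r ≤_) (trans (cong suc v≡1+u) (sym w≡2+u)) r≤1+v) w≤8+m)
                      (trans cr≡a a≡S)
    3≤|a| : 3 ≤ classSize c a
    3≤|a| = ≰⇒> λ |a|≤2 → a≢S (small-unique |a|≤2 |S|≤2)
    2≤nbr : 2 ≤ nbrInClass c v a
    2≤nbr = ≰⇒> λ nbr≤1 → 1+n≰n (≤-trans 3≤|a| (dominating-class-≤2 nbr≤1 a-dominates))
    cu≡a = nbrInClass-≥2⇒neighbour∈class proper v a 2≤nbr (inj₂ (sym v≡1+u))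
    cw≡a = nbrInClass-≥2⇒neighbour∈class proper v a 2≤nbr (inj₁ (trans (cong suc v≡1+u) (sym w≡2+u)))

  X Y : Fin k
  X = c (fromℕ< {2} (s≤s (s≤s (s≤s z≤n))))
  Y = c (fromℕ< {3} (s≤s (s≤s (s≤s (s≤s z≤n)))))

  |X|≤4 : classSize c X ≤ 4
  |X|≤4 = proj₂ (middle-step {w = fromℕ< {4} (s≤s (m≤m+n 4 (6 + m)))} (s≤s (s≤s z≤n)) refl (m≤m+n 4 (4 + m)))

  |Y|≤4 : classSize c Y ≤ 4
  |Y|≤4 = proj₂ (middle-step {w = fromℕ< {5} (s≤s (m≤m+n 5 (5 + m)))} (s≤s (s≤s z≤n)) refl (m≤m+n 5 (3 + m)))

  middle-colour-at : ∀ j {t} → toℕ t ≡ 2 + j → toℕ t ≤ 8 + m → c t ≡ X ⊎ c t ≡ Y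
  middle-colour-at 0 t≡2 _ = inj₁ (cong c (Finₚ.toℕ-injective t≡2))
  middle-colour-at 1 t≡3 _ = inj₂ (cong c (Finₚ.toℕ-injective t≡3))
  middle-colour-at (suc (suc j)) {t} t≡4+j t≤8+m =
    Sum.map (trans (sym cu≡ct)) (trans (sym cu≡ct))
      (middle-colour-at j u≡2+j (≤-trans (m≤n+m (toℕ u) 2) (≤-trans (≤-reflexive (sym t≡2+u)) t≤8+m)))
    where
    2+j<n : 2 + j < 11 + m
    2+j<n = ≤-trans (≤-trans (n≤1+n _) (≤-reflexive (sym t≡4+j))) (<⇒≤ (Finₚ.toℕ<n t))
    u : Fin (11 + m)
    u = fromℕ< 2+j<n
    u≡2+j : toℕ u ≡ 2 + j
    u≡2+j = Finₚ.toℕ-fromℕ< 2+j<n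
    t≡2+u : toℕ t ≡ 2 + toℕ u
    t≡2+u = trans t≡4+j (cong (2 +_) (sym u≡2+j))
    cu≡ct : c u ≡ c t
    cu≡ct = proj₁ (middle-step (subst (2 ≤_) (sym u≡2+j) (m≤m+n 2 j)) t≡2+u t≤8+m)

  middle-colour : ∀ {t} → Middle t → c t ≡ X ⊎ c t ≡ Y
  middle-colour {t} (2≤t , t≤8+m) = middle-colour-at (toℕ t ∸ 2) (sym (m+[n∸m]≡n 2≤t)) t≤8+m

  outer-class-small : ∀ {a} → a ≢ X → a ≢ Y → classSize c a ≤ 2
  outer-class-small {a} a≢X a≢Y =
    ≤-trans (count-⊆-∪ (inClass? c a) (inClass? c a ∩? low?) (inClass? c a ∩? high?) split) (+-mono-≤ low-≤1 high-≤1)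
    where
    low? : Decidable Low
    low? r = toℕ r ≤? 1
    high? : Decidable High
    high? r = 9 + m ≤? toℕ r
    split : ∀ {r} → c r ≡ a → (c r ≡ a × Low r) ⊎ (c r ≡ a × High r)
    split {r} cr≡a with middle-or-end r
    ... | inj₁ middle        = contradiction (subst (λ x → x ≡ X ⊎ x ≡ Y) cr≡a (middle-colour middle)) [ a≢X , a≢Y ]
    ... | inj₂ (inj₁ low)  = inj₁ (cr≡a , low)
    ... | inj₂ (inj₂ high) = inj₂ (cr≡a , high)
    low-≤1 : count (inClass? c a ∩? low?) ≤ 1
    low-≤1 = count-subsingleton (inClass? c a ∩? low?) λ (cr≡a , r≤1) (cr′≡a , r′≤1) →
      proper-near proper (≤-trans r≤1 (s≤s z≤n)) (≤-trans r′≤1 (s≤s z≤n)) (trans cr≡a (sym cr′≡a))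
    high-≤1 : count (inClass? c a ∩? high?) ≤ 1
    high-≤1 = count-subsingleton (inClass? c a ∩? high?) λ {r} {r′} (cr≡a , 9+m≤r) (cr′≡a , 9+m≤r′) →
      proper-near proper (≤-trans (Finₚ.toℕ≤pred[n] r) (s≤s 9+m≤r′)) (≤-trans (Finₚ.toℕ≤pred[n] r′) (s≤s 9+m≤r))
                         (trans cr≡a (sym cr′≡a))

  every-colour : ∀ t → c t ≡ S ⊎ c t ≡ X ⊎ c t ≡ Y
  every-colour t with (c t Finₚ.≟ X) ⊎-dec (c t Finₚ.≟ Y)
  ... | yes ct∈XY = inj₂ ct∈XY
  ... | no  ct∉XY = inj₁ (small-unique (outer-class-small (ct∉XY ∘ inj₁) (ct∉XY ∘ inj₂)) |S|≤2)

  impossible : ⊥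
  impossible = 1+n≰n (≤-trans (m≤m+n 11 m) (begin
    11 + m                      ≡⟨ count-full everything? (λ _ → tt) ⟨
    count everything?           ≤⟨ count-⊆-∪ everything? (inClass? c S) X∪Y? (λ {t} _ → every-colour t) ⟩
    classSize c S + count X∪Y?  ≤⟨ +-mono-≤ |S|≤2 (≤-trans (count-∪ (inClass? c X) (inClass? c Y)) (+-mono-≤ |X|≤4 |Y|≤4)) ⟩
    10                          ∎))
    where
    open ≤-Reasoning
    everything? : Decidable {A = Fin (11 + m)} U
    everything? = U?
    X∪Y? = inClass? c X ∪? inClass? c Y

one-small-class-impossible : ∀ {n k} {c : Fin n → Fin k} → Proper c → MajorityDominated c → 11 ≤ n →
                             ¬ (∀ {a b} → classSize c a ≤ 2 → classSize c b ≤ 2 → a ≡ b)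
one-small-class-impossible proper dominated (s≤s (s≤s (s≤s (s≤s (s≤s (s≤s (s≤s (s≤s (s≤s (s≤s (s≤s z≤n))))))))))) =
  OneSmallClass.impossible proper dominated

at-least-two-small-classes : ∀ {n k} {c : Fin n → Fin k} → Proper c → MajorityDominated c → 11 ≤ n →
                             2 ≤ count (λ a → classSize c a ≤? 2)
at-least-two-small-classes {c = c} proper dominated 11≤n = ≰⇒> λ count≤1 →
  one-small-class-impossible proper dominated 11≤n (count-≤1⇒subsingleton (λ a → classSize c a ≤? 2) count≤1)

-- (3) At most one colour appears on exactly one vertex

module Singletons {n k} (χ : IsChiMd n k) {c : Fin n → Fin k} (proper : Proper c) (dominated : MajorityDominated c) where

  Alone : Fin n → Set
  Alone u = ∀ {w} → c w ≡ c u → w ≡ u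

  module Merge {u w : Fin n} (alone-u : Alone u) (alone-w : Alone w) (u≢w : u ≢ w) (u≁w : ¬ Adj u w) where

    merged : Fin n → Fin k
    merged = updateAt c w (λ _ → c u)

    merged-spec : ∀ t → (t ≡ w × merged t ≡ c u) ⊎ (t ≢ w × merged t ≡ c t)
    merged-spec t with t Finₚ.≟ w
    ... | yes refl = inj₁ (refl , updateAt-updates w c)
    ... | no  t≢w  = inj₂ (t≢w , updateAt-minimal t w c t≢w)

    cu≢cw : c u ≢ c w
    cu≢cw cu≡cw = u≢w (sym (alone-u (sym cu≡cw)))

    merged-class : ∀ {t} → merged t ≡ c u → t ≡ u ⊎ t ≡ w
    merged-class {t} mt≡cu with merged-spec t
    ... | inj₁ (t≡w , _)  = inj₂ t≡w
    ... | inj₂ (_ , mt)   = inj₁ (alone-u (trans (sym mt) mt≡cu))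

    merged-u-w : ∀ {t} → t ≡ u ⊎ t ≡ w → merged t ≡ c u
    merged-u-w {t} t∈uw with merged-spec t | t∈uw
    ... | inj₁ (_ , mt)   | _         = mt
    ... | inj₂ (_ , mt)   | inj₁ refl = mt
    ... | inj₂ (t≢w , _)  | inj₂ t≡w  = contradiction t≡w t≢w

    merged-proper : Proper merged
    merged-proper i j i~j mi≡mj with merged-spec i | merged-spec j
    ... | inj₁ (refl , _) | inj₁ (refl , _)   = Adj-irrefl i~j
    ... | inj₁ (refl , mi) | inj₂ (_ , mj)    =
      u≁w (subst (λ j → Adj j w) (alone-u (trans (sym mj) (trans (sym mi≡mj) mi))) (Adj-sym i~j))
    ... | inj₂ (_ , mi) | inj₁ (refl , mj)    =
      u≁w (subst (λ i → Adj i w) (alone-u (trans (sym mi) (trans mi≡mj mj))) i~j)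
    ... | inj₂ (_ , mi) | inj₂ (_ , mj)       = proper i j i~j (trans (sym mi) (trans mi≡mj mj))

    merged-misses : ∀ t → merged t ≢ c w
    merged-misses t mt≡cw with merged-spec t
    ... | inj₁ (_ , mt)     = cu≢cw (trans (sym mt) mt≡cw)
    ... | inj₂ (t≢w , mt)   = t≢w (alone-w (trans (sym mt) mt≡cw))

    merged-dominated : MajorityDominated merged
    merged-dominated v with dominated v
    ... | a , c-dominates with (a Finₚ.≟ c u) ⊎-dec (a Finₚ.≟ c w)
    ...   | yes a∈uw =
      let (m , cm≡a , vm) = dominates-member c-dominates
          m∈uw = Sum.map (λ a≡cu → alone-u (trans cm≡a a≡cu)) (λ a≡cw → alone-w (trans cm≡a a≡cw)) a∈uw
      in c u , small-class-dominates (count-⊆-pair _ merged-class) (merged-u-w m∈uw) vm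
    ...   | no  a∉uw = a , dominates-transfer to from c-dominates
      where
      to : ∀ {t} → c t ≡ a → merged t ≡ a
      to {t} ct≡a with merged-spec t
      ... | inj₁ (refl , _) = contradiction (inj₂ (sym ct≡a)) a∉uw
      ... | inj₂ (_ , mt)   = trans mt ct≡a
      from : ∀ {t} → merged t ≡ a → c t ≡ a
      from {t} mt≡a with merged-spec t
      ... | inj₁ (_ , mt)   = contradiction (inj₁ (trans (sym mt≡a) mt)) a∉uw
      ... | inj₂ (_ , mt)   = trans (sym mt) mt≡a

    impossible : ⊥
    impossible = optimal-uses-every-colour χ merged merged-proper merged-dominated (c w) merged-misses

  -- The class of x becomes {x, z}, and the class of z trades z for y.
  module Swap {x y z : Fin n} (alone-x : Alone x) (alone-y : Alone y) (y~x : Adj y x) (y~z : Adj y z) (x≢z : x ≢ z) where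

    swapped : Fin n → Fin k
    swapped t with t Finₚ.≟ y | t Finₚ.≟ z
    ... | yes _ | _     = c z
    ... | no  _ | yes _ = c x
    ... | no  _ | no  _ = c t

    position : ∀ t → t ≡ y ⊎ t ≡ z ⊎ (t ≢ y × t ≢ z)
    position t with t Finₚ.≟ y | t Finₚ.≟ z
    ... | yes t≡y | _       = inj₁ t≡y
    ... | no  _   | yes t≡z = inj₂ (inj₁ t≡z)
    ... | no  t≢y | no  t≢z = inj₂ (inj₂ (t≢y , t≢z))

    y≢z : y ≢ z
    y≢z refl = Adj-irrefl y~z

    x≢y : x ≢ y
    x≢y refl = Adj-irrefl y~x

    swapped-y : swapped y ≡ c z
    swapped-y with y Finₚ.≟ y
    ... | yes _   = refl
    ... | no  y≢y = contradiction refl y≢y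

    swapped-z : swapped z ≡ c x
    swapped-z with z Finₚ.≟ y | z Finₚ.≟ z
    ... | yes z≡y | _       = contradiction (sym z≡y) y≢z
    ... | no  _   | yes _   = refl
    ... | no  _   | no  z≢z = contradiction refl z≢z

    swapped-fixed : ∀ {t} → t ≢ y → t ≢ z → swapped t ≡ c t
    swapped-fixed {t} t≢y t≢z with t Finₚ.≟ y | t Finₚ.≟ z
    ... | yes t≡y | _       = contradiction t≡y t≢y
    ... | no  _   | yes t≡z = contradiction t≡z t≢z
    ... | no  _   | no  _   = refl

    cz≢cx : c z ≢ c x
    cz≢cx cz≡cx = x≢z (sym (alone-x cz≡cx))

    swapped-class-x : ∀ {t} → swapped t ≡ c x → t ≡ x ⊎ t ≡ z
    swapped-class-x {t} st≡cx with position t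
    ... | inj₁ refl                 = contradiction (trans (sym swapped-y) st≡cx) cz≢cx
    ... | inj₂ (inj₁ t≡z)           = inj₂ t≡z
    ... | inj₂ (inj₂ (t≢y , t≢z))   = inj₁ (alone-x (trans (sym (swapped-fixed t≢y t≢z)) st≡cx))

    moved-≢ : ∀ {i j} → Adj i j → i ≡ y ⊎ i ≡ z → swapped i ≢ swapped j
    moved-≢ {j = j} y~j (inj₁ refl) si≡sj =
      cz≢cx (trans (sym swapped-y) (trans si≡sj ([ (λ { refl → swapped-fixed x≢y x≢z }) , (λ { refl → swapped-z }) ]
                                                  (neighbours-of-middle y~x y~z x≢z y~j))))
    moved-≢ {j = j} z~j (inj₂ refl) si≡sj with position j
    ... | inj₁ refl               = cz≢cx (sym (trans (sym swapped-z) (trans si≡sj swapped-y)))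
    ... | inj₂ (inj₁ refl)        = Adj-irrefl z~j
    ... | inj₂ (inj₂ (j≢y , j≢z)) =
      common-neighbour⇒¬Adj y~z y~x
        (subst (Adj z) (alone-x (trans (sym (swapped-fixed j≢y j≢z)) (trans (sym si≡sj) swapped-z))) z~j)

    swapped-proper : Proper swapped
    swapped-proper i j i~j with position i | position j
    ... | inj₁ i≡y               | _                       = moved-≢ i~j (inj₁ i≡y)
    ... | inj₂ (inj₁ i≡z)        | _                       = moved-≢ i~j (inj₂ i≡z)
    ... | inj₂ (inj₂ _)          | inj₁ j≡y                = moved-≢ (Adj-sym i~j) (inj₁ j≡y) ∘ sym
    ... | inj₂ (inj₂ _)          | inj₂ (inj₁ j≡z)         = moved-≢ (Adj-sym i~j) (inj₂ j≡z) ∘ sym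
    ... | inj₂ (inj₂ (i≢y , i≢z)) | inj₂ (inj₂ (j≢y , j≢z)) = λ si≡sj →
      proper i j i~j (trans (sym (swapped-fixed i≢y i≢z)) (trans si≡sj (swapped-fixed j≢y j≢z)))

    swapped-misses : ∀ t → swapped t ≢ c y
    swapped-misses t st≡cy with position t
    ... | inj₁ refl               = proper y z y~z (sym (trans (sym swapped-y) st≡cy))
    ... | inj₂ (inj₁ refl)        = x≢y (alone-y (trans (sym swapped-z) st≡cy))
    ... | inj₂ (inj₂ (t≢y , t≢z)) = t≢y (alone-y (trans (sym (swapped-fixed t≢y t≢z)) st≡cy))

    class-z-not-larger : classSize swapped (c z) ≤ classSize c (c z)
    class-z-not-larger = begin
      classSize swapped (c z)                        ≡⟨ count-except (inClass? swapped (c z)) swapped-y ⟩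
      suc (count (inClass? swapped (c z) except y))  ≤⟨ s≤s others-moved-back ⟩
      suc (count (inClass? c (c z) except z))        ≡⟨ count-except (inClass? c (c z)) refl ⟨
      classSize c (c z)                              ∎
      where
      open ≤-Reasoning
      moved-back : ∀ {t} → swapped t ≡ c z × t ≢ y → c t ≡ c z × t ≢ z
      moved-back {t} (st≡cz , t≢y) with position t
      ... | inj₁ t≡y                = contradiction t≡y t≢y
      ... | inj₂ (inj₁ refl)        = contradiction (trans (sym st≡cz) swapped-z) cz≢cx
      ... | inj₂ (inj₂ (_ , t≢z))   = trans (sym (swapped-fixed t≢y t≢z)) st≡cz , t≢z
      others-moved-back : count (inClass? swapped (c z) except y) ≤ count (inClass? c (c z) except z)
      others-moved-back = count-mono (inClass? swapped (c z) except y) (inClass? c (c z) except z) moved-back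

    class-x-dominates : ∀ {v} → InN v x ⊎ InN v z → Dominates swapped v (c x)
    class-x-dominates (inj₁ vx) = small-class-dominates class-x-≤2 (swapped-fixed x≢y x≢z) vx
      where class-x-≤2 = count-⊆-pair (inClass? swapped (c x)) swapped-class-x
    class-x-dominates (inj₂ vz) = small-class-dominates class-x-≤2 swapped-z vz
      where class-x-≤2 = count-⊆-pair (inClass? swapped (c x)) swapped-class-x

    near-y : ∀ {v} → InN v y → InN v x ⊎ InN v z
    near-y (inj₁ refl) = inj₁ (inj₂ y~x)
    near-y (inj₂ v~y) with neighbours-of-middle y~x y~z x≢z (Adj-sym v~y)
    ... | inj₁ refl = inj₁ (inj₁ refl)
    ... | inj₂ refl = inj₂ (inj₁ refl)

    untouched-class-dominates : ∀ {v a} → a ≢ c x → a ≢ c y → ¬ InN v z → Dominates c v a → Dominates swapped v a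
    untouched-class-dominates {v} {a} a≢cx a≢cy ¬vz = dominates-mono size≤ nbr≤
      where
      nbr≤ : nbrInClass c v a ≤ nbrInClass swapped v a
      nbr≤ = count-mono (inClassNear? c v a) (inClassNear? swapped v a) λ {t} (ct≡a , vt) → kept t ct≡a vt , vt
        where
        kept : ∀ t → c t ≡ a → InN v t → swapped t ≡ a
        kept t ct≡a vt with position t
        ... | inj₁ refl               = contradiction (sym ct≡a) a≢cy
        ... | inj₂ (inj₁ refl)        = contradiction vt ¬vz
        ... | inj₂ (inj₂ (t≢y , t≢z)) = trans (swapped-fixed t≢y t≢z) ct≡a
      size≤ : classSize swapped a ≤ classSize c a
      size≤ with a Finₚ.≟ c z
      ... | yes refl = class-z-not-larger
      ... | no a≢cz  = count-mono (inClass? swapped a) (inClass? c a) λ {t} st≡a → kept t st≡a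
        where
        kept : ∀ t → swapped t ≡ a → c t ≡ a
        kept t st≡a with position t
        ... | inj₁ refl               = contradiction (trans (sym st≡a) swapped-y) a≢cz
        ... | inj₂ (inj₁ refl)        = contradiction (trans (sym st≡a) swapped-z) a≢cx
        ... | inj₂ (inj₂ (t≢y , t≢z)) = trans (sym (swapped-fixed t≢y t≢z)) st≡a

    swapped-dominated : MajorityDominated swapped
    swapped-dominated v with dominated v
    ... | a , c-dominates with a Finₚ.≟ c x | a Finₚ.≟ c y | InN? v z
    ...   | yes a≡cx | _        | _      = let (m , cm≡a , vm) = dominates-member c-dominates in
      c x , class-x-dominates (inj₁ (subst (InN v) (alone-x (trans cm≡a a≡cx)) vm))
    ...   | no  _    | yes a≡cy | _      = let (m , cm≡a , vm) = dominates-member c-dominates in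
      c x , class-x-dominates (near-y (subst (InN v) (alone-y (trans cm≡a a≡cy)) vm))
    ...   | no  _    | no  _    | yes vz = c x , class-x-dominates (inj₂ vz)
    ...   | no  a≢cx | no  a≢cy | no ¬vz = a , untouched-class-dominates a≢cx a≢cy ¬vz c-dominates

    impossible : ⊥
    impossible = optimal-uses-every-colour χ swapped swapped-proper swapped-dominated (c y) swapped-misses

  singleton-class : ∀ {a} → classSize c a ≡ 1 → ∃ λ u → c u ≡ a × Alone u
  singleton-class {a} size≡1 =
    let (u , cu≡a) = count-witness (inClass? c a) (≤-reflexive (sym size≡1))
    in u , cu≡a , λ cw≡cu → count-≤1⇒subsingleton (inClass? c a) (≤-reflexive size≡1) (trans cw≡cu cu≡a) cu≡a

  adjacent-singletons : n ≢ 2 → ∀ {p q} → Alone p → Alone q → suc (toℕ p) ≡ toℕ q → ⊥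
  adjacent-singletons n≢2 alone-p alone-q 1+p≡q with third-vertex n≢2 1+p≡q
  ... | _ , inj₁ (q~z , z≢p) = Swap.impossible alone-p alone-q (inj₂ 1+p≡q) q~z (z≢p ∘ sym)
  ... | _ , inj₂ (p~z , z≢q) = Swap.impossible alone-q alone-p (inj₁ 1+p≡q) p~z (z≢q ∘ sym)

  two-singletons : n ≢ 2 → ∀ {u w} → Alone u → Alone w → u ≢ w → ⊥
  two-singletons n≢2 {u} {w} alone-u alone-w u≢w with Adj? u w
  ... | no  u≁w          = Merge.impossible alone-u alone-w u≢w u≁w
  ... | yes (inj₁ 1+u≡w) = adjacent-singletons n≢2 alone-u alone-w 1+u≡w
  ... | yes (inj₂ 1+w≡u) = adjacent-singletons n≢2 alone-w alone-u 1+w≡u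

at-most-one-singleton-class : ∀ {n k} → IsChiMd n k → {c : Fin n → Fin k} → Proper c → MajorityDominated c →
                              n ≢ 2 → count (λ a → classSize c a ≟ 1) ≤ 1
at-most-one-singleton-class χ {c} proper dominated n≢2 =
  ≮⇒≥ λ 1<count → two-singleton-classes (distinct-witnesses (λ a → classSize c a ≟ 1) 1<count)
  where
  open Singletons χ proper dominated
  two-singleton-classes : (Σ (List _) λ as → length as ≡ 2 × Unique as × All (λ a → classSize c a ≡ 1) as) → ⊥
  two-singleton-classes (_ ∷ _ ∷ [] , _ , (A≢B ∷ []) ∷ _ , |A|≡1 ∷ |B|≡1 ∷ []) =
    let (u , cu≡A , alone-u) = singleton-class |A|≡1
        (w , cw≡B , alone-w) = singleton-class |B|≡1
    in two-singletons n≢2 alone-u alone-w λ u≡w → A≢B (trans (sym cu≡A) (trans (cong c u≡w) cw≡B))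

lemma3p5 : ∀ (n k : ℕ) → IsChiMd n k → (c : Fin n → Fin k) → IsMDColoring c →
    (count (λ a → 5 ≤? classSize c a) ≤ 2) ×
    (n ≥ 11 → count (λ a → classSize c a ≤? 2) ≥ 2) ×
    (n ≢ 2 → count (λ a → classSize c a ≟ 1) ≤ 1)
lemma3p5 n k χ c md =
  at-most-two-large-classes χ proper dominated ,
  at-least-two-small-classes proper dominated ,
  at-most-one-singleton-class χ proper dominated
  where
  proper = proj₁ md
  dominated = isMDColoring⇒majorityDominated md
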